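{- Let $F$ be a finite forest whose vertices are each colored white or blue and carry distinct integer labels, and let $C$ be a connected component of $F$. If $C$ contains a triplet vertex, then $C$ contains a triplet head.
   Context: All degrees $d(\cdot)$ and neighborhoods $\Gamma(\cdot)$ are taken in $F$. A path $(v_1,\dots,v_k)$, $k\ge1$, is a tail (of length $k$, with lead $v_1$) if there is $v_0$ adjacent to $v_1$ with $(v_0,\dots,v_k)$ a path, $d(v_0)>2$, $d(v_k)=1$, and $d(v_i)=2$ for $0<i<k$; it is white if all its vertices are white. Let $\mathcal{WT}_2$ be the set of leads of white tails of length $2$. Define sets $\mathcal{TT}_i$ (triplet vertices) and $\mathcal{PW}_i$ (potential triplet witnesses) for $i\ge1$ by $\mathcal{TT}_1=\emptyset$, $\mathcal{PW}_1=\mathcal{WT}_2$, and $\mathcal{TT}_{i+1}=\mathcal{TT}_i\cup\{v: |\Gamma(v)\cap\mathcal{PW}_i|\ge3\}$, $\mathcal{PW}_{i+1}=\{v\in\mathcal{TT}_{i+1}: v \text{ white and } d(v)=4\}\cup\mathcal{WT}_2$. For each $v\in\mathcal{TT}_{i+1}\setminus\mathcal{TT}_i$, set its triplet depth $td(v)=i+1$ and choose three triplet witnesses of $v$ from $\Gamma(v)\cap\mathcal{PW}_i$, preferring (in this order of priority) vertices of $\mathcal{WT}_2$, then vertices of lower triplet depth, then vertices with higher labels. A triplet vertex is a vertex of $\mathcal{TT}=\bigcup_i\mathcal{TT}_i$. A triplet head is a triplet vertex that is not a triplet witness of any triplet vertex. -}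

module Defs where

open import Data.Nat using (ℕ; zero; suc; _+_; _<_; _>_)
open import Data.Integer as ℤ using (ℤ)
open import Data.Fin using (Fin)
open import Data.Bool using (Bool; true; false; if_then_else_; T)
open import Data.List using (List; []; _∷_; _++_; [_]; map; allFin; length)
open import Data.Nat.ListAction using (sum)
open import Data.List.Relation.Unary.All using (All)
open import Data.List.Relation.Unary.Linked using (Linked)
open import Data.List.Relation.Unary.Unique.Propositional using (Unique)
open import Data.Product using (Σ; ∃; ∃-syntax; _×_; _,_)
open import Data.Sum using (_⊎_)
open import Relation.Nullary using (¬_)
open import Relation.Binary.PropositionalEquality using (_≡_; _≢_)
open import Relation.Binary.Construct.Closure.ReflexiveTransitive using (Star)
open import Function.Definitions using (Injective)

record Graph (n : ℕ) : Set where
  field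
    adj      : Fin n → Fin n → Bool
    adj-sym  : ∀ u v → adj u v ≡ adj v u
    adj-irr  : ∀ v → adj v v ≡ false

  Adj : Fin n → Fin n → Set
  Adj u v = T (adj u v)

  IsPath : List (Fin n) → Set
  IsPath vs = Unique vs × Linked Adj vs

  IsCycle : List (Fin n) → Set
  IsCycle vs = IsPath vs × 3 Data.Nat.≤ length vs
             × ∃[ v ] ∃[ ws ] ∃[ w ] (vs ≡ v ∷ ws ++ [ w ] × Adj w v)

  Acyclic : Set
  Acyclic = ∀ vs → ¬ IsCycle vs

  deg : Fin n → ℕ
  deg v = sum (map (λ u → if adj v u then 1 else 0) (allFin n))

  Reach : Fin n → Fin n → Set
  Reach = Star Adj

record ColouredForest (n : ℕ) : Set where
  field
    graph     : Graph n
    acyclic   : Graph.Acyclic graph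
    white     : Fin n → Bool       -- true = white, false = blue
    label     : Fin n → ℤ
    label-inj : Injective _≡_ _≡_ label

  open Graph graph public

  White : Fin n → Set
  White v = T (white v)

  IsTail : List (Fin n) → Set
  IsTail vs = ∃[ ws ] ∃[ vk ] (vs ≡ ws ++ [ vk ] ×
                ∃[ v0 ] (IsPath (v0 ∷ vs) × deg v0 > 2 × deg vk ≡ 1
                         × All (λ u → deg u ≡ 2) ws))

  WT₂ : Fin n → Set
  WT₂ v = ∃[ w ] (IsTail (v ∷ w ∷ []) × White v × White w)

  ThreeNbrs : (Fin n → Set) → Fin n → Set
  ThreeNbrs P v = ∃[ a ] ∃[ b ] ∃[ c ] (a ≢ b × a ≢ c × b ≢ c
                   × Adj v a × Adj v b × Adj v c × P a × P b × P c)

  -- TT i and PW i for i ≥ 1; index i here stands for the paper's i+1,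
  -- i.e.  TT i = 𝒯𝒯_{i+1},  PW i = 𝒫𝒲_{i+1}.
  TT : ℕ → Fin n → Set
  PW : ℕ → Fin n → Set
  TT zero    v = Data.Empty.⊥
    where import Data.Empty
  TT (suc i) v = TT i v ⊎ ThreeNbrs (PW i) v
  PW zero    v = WT₂ v
  PW (suc i) v = (TT (suc i) v × White v × deg v ≡ 4) ⊎ WT₂ v

  TripletVertex : Fin n → Set
  TripletVertex v = ∃[ i ] TT i v

  -- triplet depth in paper's indexing: td v ≡ suc (suc i) iff
  -- v ∈ 𝒯𝒯_{i+2} \ 𝒯𝒯_{i+1}
  HasTD : Fin n → ℕ → Set
  HasTD v d = ∃[ i ] (d ≡ suc (suc i) × TT (suc i) v × ¬ TT i v)

  Preferred : Fin n → Fin n → Set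
  Preferred u w =
      (WT₂ u × ¬ WT₂ w)
    ⊎ (WT₂ u × WT₂ w × label w ℤ.< label u)
    ⊎ (¬ WT₂ u × ¬ WT₂ w × ∃[ a ] ∃[ b ] (HasTD u a × HasTD w b
         × (a < b ⊎ (a ≡ b × label w ℤ.< label u))))

  TripletWitness : Fin n → Fin n → Set
  TripletWitness v w = ∃[ i ] (TT (suc i) v × ¬ TT i v × Adj v w × PW i w
                       × ¬ ThreeNbrs (λ u → PW i u × Preferred u w) v)

  TripletHead : Fin n → Set
  TripletHead h = TripletVertex h × ¬ (∃[ v ] (TripletVertex v × TripletWitness v h))

-- A triplet vertex has degree at least 3, so it is never the lead of a white
-- tail of length 2.  Hence if a triplet vertex h is a triplet witness of u,
-- where u enters 𝒯𝒯 at stage i + 1, then h ∈ 𝒫𝒲_i forces h ∈ 𝒯𝒯_i: the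
-- neighbour u of h entered strictly later.  Walking from v to later-entering
-- triplet neighbours thus ends at a triplet head, because entry stages are
-- below n: after a stage at which no vertex enters, no vertex ever enters
-- again, so n + 1 entry stages would need n + 1 distinct vertices.
module Submission where

open import Defs
open import Data.Nat using (ℕ; zero; suc; _+_; _≤_; _<_; _≤′_; ≤′-refl; ≤′-step; _<?_; _≤?_)
open import Data.Nat.Properties
open import Data.Nat.ListAction using (sum)
open import Data.Fin using (Fin; toℕ)
open import Data.Fin.Properties using (any?; pigeonhole; toℕ≤pred[n]) renaming (_≟_ to _≟ᶠ_)
open import Data.Bool using (true; T; if_then_else_)
open import Data.List using ([]; _∷_; map)
open import Data.List.Relation.Unary.All using (_∷_; [])
open import Data.List.Relation.Unary.Any using (here; there)
open import Data.List.Relation.Unary.AllPairs using (allPairs?)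
open import Data.List.Relation.Unary.Linked using (linked?)
open import Data.List.Membership.Propositional using (_∈_)
open import Data.List.Membership.Propositional.Properties using (∈-allFin)
open import Data.Product using (∃; ∃-syntax; _×_; _,_; proj₁; proj₂)
open import Data.Sum using (inj₁; inj₂)
open import Function using (_∘_)
open import Relation.Nullary using (¬_; Dec; yes; no; contradiction)
open import Relation.Nullary.Decidable using (map′; ¬?; _×-dec_; _⊎-dec_; T?)
open import Relation.Binary.PropositionalEquality using (_≡_; _≢_; refl; sym; subst)
open import Relation.Binary.Construct.Closure.ReflexiveTransitive using (ε; _◅_)

module _ {A : Set} (f : A → ℕ) where

  1≤sum-map : ∀ {a xs} → a ∈ xs → 1 ≤ f a → 1 ≤ sum (map f xs)
  1≤sum-map {xs = x ∷ xs} (here refl) p = ≤-trans p (m≤m+n (f x) _)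
  1≤sum-map {xs = x ∷ xs} (there a∈) p = ≤-trans (1≤sum-map a∈ p) (m≤n+m _ (f x))

  2≤sum-map : ∀ {a b xs} → a ≢ b → a ∈ xs → b ∈ xs → 1 ≤ f a → 1 ≤ f b →
              2 ≤ sum (map f xs)
  2≤sum-map a≢b (here refl) (here refl) _  _  = contradiction refl a≢b
  2≤sum-map a≢b (here refl) (there b∈)  pa pb = +-mono-≤ pa (1≤sum-map b∈ pb)
  2≤sum-map a≢b (there a∈)  (here refl) pa pb = +-mono-≤ pb (1≤sum-map a∈ pa)
  2≤sum-map {xs = x ∷ _} a≢b (there a∈) (there b∈) pa pb =
    ≤-trans (2≤sum-map a≢b a∈ b∈ pa pb) (m≤n+m _ (f x))

  3≤sum-map : ∀ {a b c xs} → a ≢ b → a ≢ c → b ≢ c →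
              a ∈ xs → b ∈ xs → c ∈ xs → 1 ≤ f a → 1 ≤ f b → 1 ≤ f c →
              3 ≤ sum (map f xs)
  3≤sum-map a≢b _ _ (here refl) (here refl) _ _ _ _ = contradiction refl a≢b
  3≤sum-map _ a≢c _ (here refl) (there _) (here refl) _ _ _ = contradiction refl a≢c
  3≤sum-map _ _ b≢c (there _) (here refl) (here refl) _ _ _ = contradiction refl b≢c
  3≤sum-map _ _ b≢c (here refl) (there b∈) (there c∈) pa pb pc =
    +-mono-≤ pa (2≤sum-map b≢c b∈ c∈ pb pc)
  3≤sum-map _ a≢c _ (there a∈) (here refl) (there c∈) pa pb pc =
    +-mono-≤ pb (2≤sum-map a≢c a∈ c∈ pa pc)
  3≤sum-map a≢b _ _ (there a∈) (there b∈) (here refl) pa pb pc =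
    +-mono-≤ pc (2≤sum-map a≢b a∈ b∈ pa pb)
  3≤sum-map {xs = x ∷ _} a≢b a≢c b≢c (there a∈) (there b∈) (there c∈) pa pb pc =
    ≤-trans (3≤sum-map a≢b a≢c b≢c a∈ b∈ c∈ pa pb pc) (m≤n+m _ (f x))

module TripletStages {n : ℕ} (F : ColouredForest n) where
  open ColouredForest F

  Adj? : ∀ u v → Dec (Adj u v)
  Adj? u v = T? (adj u v)

  Adj-sym : ∀ {u v} → Adj u v → Adj v u
  Adj-sym {u} {v} = subst T (adj-sym u v)

  isPath? : ∀ vs → Dec (IsPath vs)
  isPath? vs = allPairs? (λ x y → ¬? (x ≟ᶠ y)) vs ×-dec linked? Adj? vs

  IsTail₂ : Fin n → Fin n → Set
  IsTail₂ v w = ∃[ v₀ ] (IsPath (v₀ ∷ v ∷ w ∷ []) × 2 < deg v₀ × deg w ≡ 1 × deg v ≡ 2)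

  IsTail₂⇒IsTail : ∀ {v w} → IsTail₂ v w → IsTail (v ∷ w ∷ [])
  IsTail₂⇒IsTail {v} {w} (v₀ , path , d₀ , d-w , d-v) =
    v ∷ [] , w , refl , v₀ , path , d₀ , d-w , d-v ∷ []

  IsTail⇒IsTail₂ : ∀ {v w} → IsTail (v ∷ w ∷ []) → IsTail₂ v w
  IsTail⇒IsTail₂ ([]                , _ , () , _)
  IsTail⇒IsTail₂ ((_ ∷ [])          , _ , refl , v₀ , path , d₀ , d-w , d-v ∷ []) =
    v₀ , path , d₀ , d-w , d-v
  IsTail⇒IsTail₂ ((_ ∷ _ ∷ [])      , _ , () , _)
  IsTail⇒IsTail₂ ((_ ∷ _ ∷ _ ∷ _)   , _ , () , _)

  IsTail₂? : ∀ v w → Dec (IsTail₂ v w)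
  IsTail₂? v w = any? λ v₀ →
    isPath? (v₀ ∷ v ∷ w ∷ []) ×-dec 2 <? deg v₀ ×-dec deg w ≟ 1 ×-dec deg v ≟ 2

  WT₂? : ∀ v → Dec (WT₂ v)
  WT₂? v = any? λ w →
    map′ IsTail₂⇒IsTail IsTail⇒IsTail₂ (IsTail₂? v w) ×-dec T? (white v) ×-dec T? (white w)

  ThreeNbrs? : ∀ {P : Fin n → Set} → (∀ w → Dec (P w)) → ∀ v → Dec (ThreeNbrs P v)
  ThreeNbrs? P? v = any? λ a → any? λ b → any? λ c →
    ¬? (a ≟ᶠ b) ×-dec ¬? (a ≟ᶠ c) ×-dec ¬? (b ≟ᶠ c) ×-dec
    Adj? v a ×-dec Adj? v b ×-dec Adj? v c ×-dec P? a ×-dec P? b ×-dec P? c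

  ThreeNbrs-map : ∀ {P Q : Fin n → Set} → (∀ {w} → P w → Q w) →
                  ∀ {v} → ThreeNbrs P v → ThreeNbrs Q v
  ThreeNbrs-map f (a , b , c , a≢b , a≢c , b≢c , v~a , v~b , v~c , pa , pb , pc) =
    a , b , c , a≢b , a≢c , b≢c , v~a , v~b , v~c , f pa , f pb , f pc

  TT? : ∀ i v → Dec (TT i v)
  PW? : ∀ i v → Dec (PW i v)
  TT? zero    v = no λ ()
  TT? (suc i) v = TT? i v ⊎-dec ThreeNbrs? (PW? i) v
  PW? zero    v = WT₂? v
  PW? (suc i) v = (TT? (suc i) v ×-dec T? (white v) ×-dec deg v ≟ 4) ⊎-dec WT₂? v

  WT₂⇒deg≡2 : ∀ {v} → WT₂ v → deg v ≡ 2
  WT₂⇒deg≡2 (_ , tail , _) = proj₂ (proj₂ (proj₂ (proj₂ (IsTail⇒IsTail₂ tail))))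

  ThreeNbrs⇒3≤deg : ∀ {P v} → ThreeNbrs P v → 3 ≤ deg v
  ThreeNbrs⇒3≤deg {v = v} (a , b , c , a≢b , a≢c , b≢c , v~a , v~b , v~c , _) =
    3≤sum-map indicator a≢b a≢c b≢c (∈-allFin a) (∈-allFin b) (∈-allFin c)
      (adjacent⇒1≤ v~a) (adjacent⇒1≤ v~b) (adjacent⇒1≤ v~c)
    where
    indicator : Fin n → ℕ
    indicator u = if adj v u then 1 else 0

    adjacent⇒1≤ : ∀ {u} → Adj v u → 1 ≤ indicator u
    adjacent⇒1≤ {u} v~u with adj v u
    ... | true = ≤-refl

  TT⇒3≤deg : ∀ k {v} → TT k v → 3 ≤ deg v
  TT⇒3≤deg (suc k) (inj₁ t)     = TT⇒3≤deg k t
  TT⇒3≤deg (suc k) (inj₂ three) = ThreeNbrs⇒3≤deg three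

  TT⇒¬WT₂ : ∀ {k v} → TT k v → ¬ WT₂ v
  TT⇒¬WT₂ {k} t wt = <-irrefl (sym (WT₂⇒deg≡2 wt)) (TT⇒3≤deg k t)

  TT-mono : ∀ {i k v} → i ≤ k → TT i v → TT k v
  TT-mono = TT-mono′ ∘ ≤⇒≤′
    where
    TT-mono′ : ∀ {i k v} → i ≤′ k → TT i v → TT k v
    TT-mono′ ≤′-refl      t = t
    TT-mono′ (≤′-step i≤k) t = inj₁ (TT-mono′ i≤k t)

  TT-stage-< : ∀ {a b u} → TT a u → ¬ TT b u → b < a
  TT-stage-< {a} {b} t ¬t with a ≤? b
  ... | yes a≤b = contradiction (TT-mono a≤b t) ¬t
  ... | no  a≰b = ≰⇒> a≰b

  triplet-PW⇒TT : ∀ {k i h} → TT k h → PW i h → TT i h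
  triplet-PW⇒TT {i = zero}  t wt              = contradiction wt (TT⇒¬WT₂ t)
  triplet-PW⇒TT {i = suc i} t (inj₁ (t′ , _)) = t′
  triplet-PW⇒TT {i = suc i} t (inj₂ wt)       = contradiction wt (TT⇒¬WT₂ t)

  Entering : ℕ → Fin n → Set
  Entering j v = TT (suc j) v × ¬ TT j v

  Entering-unique : ∀ {j j′ u} → Entering j u → Entering j′ u → j ≡ j′
  Entering-unique (t , ¬t) (t′ , ¬t′) =
    ≤-antisym (≤-pred (TT-stage-< t′ ¬t)) (≤-pred (TT-stage-< t ¬t′))

  ∃-Entering : ∀ {k u} → TT k u → ∃[ j ] (j < k × Entering j u)
  ∃-Entering {suc k} {u} t with TT? k u
  ... | no ¬t = k , ≤-refl , t , ¬t
  ... | yes t′ with ∃-Entering t′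
  ...   | j , j<k , e = j , m<n⇒m<1+n j<k , e

  Stable : ℕ → Set
  Stable j = ∀ v → TT (suc j) v → TT j v

  Stable⇒PW-stable : ∀ {j w} → Stable j → PW (suc j) w → PW j w
  Stable⇒PW-stable {zero}  S (inj₁ (t , _))      = contradiction (S _ t) λ ()
  Stable⇒PW-stable {suc j} S (inj₁ (t , w-w , d)) = inj₁ (S _ t , w-w , d)
  Stable⇒PW-stable {zero}  S (inj₂ wt)            = wt
  Stable⇒PW-stable {suc j} S (inj₂ wt)            = inj₂ wt

  Stable-suc : ∀ {j} → Stable j → Stable (suc j)
  Stable-suc S v (inj₁ t)     = t
  Stable-suc S v (inj₂ three) = inj₂ (ThreeNbrs-map (Stable⇒PW-stable S) three)

  Stable-mono : ∀ {j m} → j ≤′ m → Stable j → Stable m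
  Stable-mono ≤′-refl        S = S
  Stable-mono (≤′-step j≤m) S = Stable-suc (Stable-mono j≤m S)

  ∃-Entering-below : ∀ {m u} → Entering m u → ∀ j → j ≤ m → ∃ (Entering j)
  ∃-Entering-below {m} {u} (t , ¬t) j j≤m
    with any? (λ w → TT? (suc j) w ×-dec ¬? (TT? j w))
  ... | yes e  = e
  ... | no ¬e = contradiction (Stable-mono (≤⇒≤′ j≤m) stable u t) ¬t
    where
    stable : Stable j
    stable v t-v with TT? j v
    ... | yes t′ = t′
    ... | no ¬t′ = contradiction (v , t-v , ¬t′) ¬e

  enterers : ∀ {m u} → n ≤ m → Entering m u → (k : Fin (suc n)) → ∃ (Entering (toℕ k))
  enterers n≤m e k = ∃-Entering-below e (toℕ k) (≤-trans (toℕ≤pred[n] k) n≤m)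

  ¬Entering-from-n : ∀ {m u} → n ≤ m → ¬ Entering m u
  ¬Entering-from-n n≤m e with pigeonhole ≤-refl (proj₁ ∘ enterers n≤m e)
  ... | i , j , i<j , same = <-irrefl (Entering-unique (proj₂ (enterers n≤m e i)) i-enters-at-j) i<j
    where
    i-enters-at-j : Entering (toℕ j) (proj₁ (enterers n≤m e i))
    i-enters-at-j = subst (Entering (toℕ j)) (sym same) (proj₂ (enterers n≤m e j))

  Entering⇒<n : ∀ {m u} → Entering m u → m < n
  Entering⇒<n e = ≰⇒> (λ n≤m → ¬Entering-from-n n≤m e)

  TT-bounded : ∀ {k u} → TT k u → TT n u
  TT-bounded t with ∃-Entering t
  ... | _ , _ , e = TT-mono (Entering⇒<n e) (proj₁ e)

  LaterNeighbour : Fin n → ℕ → Set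
  LaterNeighbour x j = ∃[ u ] (Adj x u × TT n u × ¬ TT (suc j) u)

  LaterNeighbour? : ∀ x j → Dec (LaterNeighbour x j)
  LaterNeighbour? x j = any? λ u → Adj? x u ×-dec TT? n u ×-dec ¬? (TT? (suc j) u)

  ¬LaterNeighbour⇒TripletHead : ∀ {j h} → Entering j h → ¬ LaterNeighbour h j → TripletHead h
  ¬LaterNeighbour⇒TripletHead {j} {h} (t , ¬t) ¬later =
    (suc j , t) , λ (u , _ , i , t-u , ¬t-u , u~h , pw , _) →
      ¬later (u , Adj-sym u~h , TT-bounded t-u ,
              ¬t-u ∘ TT-mono (TT-stage-< (triplet-PW⇒TT t pw) ¬t))

  TripletHead-reachable-from : ∀ fuel {x j} → n ≤ j + fuel → Entering j x →
                               ∃[ h ] (Reach x h × TripletHead h)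
  TripletHead-reachable-from zero {j = j} n≤j e =
    contradiction (subst (n ≤_) (+-identityʳ j) n≤j) (<⇒≱ (Entering⇒<n e))
  TripletHead-reachable-from (suc fuel) {x} {j} n≤j+fuel e with LaterNeighbour? x j
  ... | no ¬later = x , ε , ¬LaterNeighbour⇒TripletHead e ¬later
  ... | yes (u , x~u , t-u , ¬t-u) with ∃-Entering t-u
  ...   | j′ , _ , e′@(t′ , _) =
    let h , u↝h , head = TripletHead-reachable-from fuel n≤j′+fuel e′
    in  h , x~u ◅ u↝h , head
    where
    n≤j′+fuel : n ≤ j′ + fuel
    n≤j′+fuel = ≤-trans n≤j+fuel (≤-trans (≤-reflexive (+-suc j fuel))
                                          (+-monoˡ-≤ fuel (≤-pred (TT-stage-< t′ ¬t-u))))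

  TripletHead-reachable : ∀ {v} → TripletVertex v → ∃[ h ] (Reach v h × TripletHead h)
  TripletHead-reachable (_ , t) with ∃-Entering t
  ... | j , _ , e = TripletHead-reachable-from n (m≤n+m n j) e

claim6 : (n : ℕ) (F : ColouredForest n) (v : Fin n) →
         ColouredForest.TripletVertex F v →
         ∃[ h ] (ColouredForest.Reach F v h × ColouredForest.TripletHead F h)
claim6 n F v = TripletStages.TripletHead-reachable F
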